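{- Let $\mathbf{A}=\langle A,\oplus,{}^*,0,\diamond,i\rangle$ be a CMV-algebra. Then there exists an injective monoid homomorphism from $\langle A,\diamond,i\rangle$ to $E(\mathbf{A}_{\mathcal{MV}})$; namely $y\mapsto\mu_y$ where $\mu_y(x)=x\diamond y$.
   Context: An MV-algebra is a structure $\langle A,\oplus,{}^*,0\rangle$ of type $(2,1,0)$ satisfying: $(x\oplus y)\oplus z=x\oplus(y\oplus z)$, $x\oplus y=y\oplus x$, $x\oplus 0=x$, $(x^*)^*=x$, $x\oplus 0^*=0^*$, $(x^*\oplus y)^*\oplus y=(y^*\oplus x)^*\oplus x$. A CMV-algebra is a structure $\langle A,\oplus,{}^*,0,\diamond,i\rangle$ such that $\mathbf{A}_{\mathcal{MV}}=\langle A,\oplus,{}^*,0\rangle$ is an MV-algebra, $\langle A,\diamond,i\rangle$ is a monoid, and for all $x,y,z$: $(y\oplus z)\diamond x=(y\diamond x)\oplus(z\diamond x)$, $x^*\diamond y=(x\diamond y)^*$, $0\diamond x=0$. For an MV-algebra $\mathbf{B}$, $E(\mathbf{B})$ denotes the monoid of MV-algebra endomorphisms of $\mathbf{B}$ with operation $\boxdot$ defined by $(f\boxdot g)(a)=g(f(a))$ and neutral element the identity map. -}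

module Defs where

open import Level using (Level; suc; _⊔_)
open import Relation.Binary.PropositionalEquality using (_≡_)
open import Data.Product using (_×_; Σ; Σ-syntax; _,_)
open import Function using (id)

record MVAlgebra (a : Level) : Set (suc a) where
  infixl 6 _⊕_
  field
    Carrier : Set a
    _⊕_     : Carrier → Carrier → Carrier
    _*      : Carrier → Carrier
    𝟘       : Carrier
    ⊕-assoc : ∀ x y z → (x ⊕ y) ⊕ z ≡ x ⊕ (y ⊕ z)
    ⊕-comm  : ∀ x y → x ⊕ y ≡ y ⊕ x
    ⊕-idʳ   : ∀ x → x ⊕ 𝟘 ≡ x
    *-invol : ∀ x → (x *) * ≡ x
    ⊕-absorb : ∀ x → x ⊕ (𝟘 *) ≡ 𝟘 *
    luk     : ∀ x y → ((x *) ⊕ y) * ⊕ y ≡ ((y *) ⊕ x) * ⊕ x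

record CMVAlgebra (a : Level) : Set (suc a) where
  infixl 7 _⋄_
  field
    mv : MVAlgebra a
  open MVAlgebra mv public
  field
    _⋄_      : Carrier → Carrier → Carrier
    i        : Carrier
    ⋄-assoc  : ∀ x y z → (x ⋄ y) ⋄ z ≡ x ⋄ (y ⋄ z)
    ⋄-idˡ    : ∀ x → i ⋄ x ≡ x
    ⋄-idʳ    : ∀ x → x ⋄ i ≡ x
    ⋄-distribʳ-⊕ : ∀ x y z → (y ⊕ z) ⋄ x ≡ (y ⋄ x) ⊕ (z ⋄ x)
    *-⋄      : ∀ x y → (x *) ⋄ y ≡ (x ⋄ y) *
    𝟘-⋄      : ∀ x → 𝟘 ⋄ x ≡ 𝟘

module _ {a : Level} (B : MVAlgebra a) where
  open MVAlgebra B

  IsMVEndo : (Carrier → Carrier) → Set a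
  IsMVEndo f = (∀ x y → f (x ⊕ y) ≡ f x ⊕ f y)
             × (∀ x → f (x *) ≡ (f x) *)
             × (f 𝟘 ≡ 𝟘)

  End : Set a
  End = Σ[ f ∈ (Carrier → Carrier) ] IsMVEndo f

  _≈E_ : End → End → Set a
  (f , _) ≈E (g , _) = ∀ x → f x ≡ g x

  _⊡_ : End → End → End
  (f , f⊕ , f* , f0) ⊡ (g , g⊕ , g* , g0) =
      (λ x → g (f x))
    , (λ x y → Relation.Binary.PropositionalEquality.trans
                 (Relation.Binary.PropositionalEquality.cong g (f⊕ x y)) (g⊕ (f x) (f y)))
    , (λ x → Relation.Binary.PropositionalEquality.trans
                 (Relation.Binary.PropositionalEquality.cong g (f* x)) (g* (f x)))
    , Relation.Binary.PropositionalEquality.trans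
        (Relation.Binary.PropositionalEquality.cong g f0) g0

  idE : End
  idE = id , (λ _ _ → Relation.Binary.PropositionalEquality.refl)
           , (λ _ → Relation.Binary.PropositionalEquality.refl)
           , Relation.Binary.PropositionalEquality.refl

module _ {a : Level} (A : CMVAlgebra a) where
  open CMVAlgebra A

  IsInjMonoidHomToE : (Carrier → End mv) → Set a
  IsInjMonoidHomToE φ =
      (∀ y z → _≈E_ mv (φ (y ⋄ z)) (_⊡_ mv (φ y) (φ z)))
    × (_≈E_ mv (φ i) (idE mv))
    × (∀ y z → _≈E_ mv (φ y) (φ z) → y ≡ z)

module Submission where

-- For y in a CMV-algebra A, right multiplication μ y = (λ x → x ⋄ y) is an
-- MV-algebra endomorphism of the MV-reduct of A: the axioms of a CMV-algebra
-- say precisely that ⋄ distributes over ⊕ on the left, commutes with ^* in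
-- its left argument, and annihilates 0 from the left.  The map y ↦ μ y is a
-- monoid homomorphism into E(A_MV) because ⊡ composes in diagrammatic order,
-- so (μ y ⊡ μ z)(x) = (x ⋄ y) ⋄ z, which is x ⋄ (y ⋄ z) by associativity;
-- and μ i is the identity since i is a right unit.  Injectivity follows by
-- evaluating at the left unit: y = i ⋄ y = μ y i = μ z i = i ⋄ z = z.

open import Defs
open import Level using (Level)
open import Relation.Binary.PropositionalEquality using (_≡_; refl; sym; module ≡-Reasoning)
open import Data.Product using (Σ; Σ-syntax; _×_; proj₁; _,_)

module RightMultiplication {a : Level} (A : CMVAlgebra a) where
  open CMVAlgebra A
  open ≡-Reasoning

  ⋄ʳ-isMVEndo : ∀ y → IsMVEndo mv (λ x → x ⋄ y)
  ⋄ʳ-isMVEndo y = (λ x z → ⋄-distribʳ-⊕ y x z) , (λ x → *-⋄ x y) , 𝟘-⋄ y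

  μ : Carrier → End mv
  μ y = (λ x → x ⋄ y) , ⋄ʳ-isMVEndo y

  μ-hom : ∀ y z → _≈E_ mv (μ (y ⋄ z)) (_⊡_ mv (μ y) (μ z))
  μ-hom y z x = sym (⋄-assoc x y z)

  μ-unit : _≈E_ mv (μ i) (idE mv)
  μ-unit = ⋄-idʳ

  μ-injective : ∀ y z → _≈E_ mv (μ y) (μ z) → y ≡ z
  μ-injective y z μy≈μz = begin
    y      ≡⟨ sym (⋄-idˡ y) ⟩
    i ⋄ y  ≡⟨ μy≈μz i ⟩
    i ⋄ z  ≡⟨ ⋄-idˡ z ⟩
    z      ∎

  μ-isInjMonoidHom : IsInjMonoidHomToE A μ
  μ-isInjMonoidHom = μ-hom , μ-unit , μ-injective

mainTheorem7 : {a : Level} (A : CMVAlgebra a) →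
    Σ[ μ ∈ (CMVAlgebra.Carrier A → End (CMVAlgebra.mv A)) ]
    (IsInjMonoidHomToE A μ
    × (∀ y x → proj₁ (μ y) x ≡ CMVAlgebra._⋄_ A x y))
mainTheorem7 A = μ , μ-isInjMonoidHom , λ _ _ → refl
  where open RightMultiplication A
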